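{- Let $D$ be a finite set and $R\subseteq D^r$ with $r\ge2$ such that every partial function in $I_D(U_r)$ is a partial polymorphism of $R$. Then for all positive integers $p,q$ with $p/q>r-1$, every partial function in $I_D(U_p^q)$ is a partial polymorphism of $R$.
   Context: An $n$-ary polymorphism pattern over variables $V$ is a set of pairs $((v_1,\dots,v_n),v)$, $v_i,v\in V$. $I_D(P)$ is the set of partial functions $f$ from $D^n$ to $D$ such that for each $((v_1,\dots,v_n),v)\in P$ and each $g:\{v_1,\dots,v_n,v\}\to D$, $(g(v_1),\dots,g(v_n))$ is in the domain of $f$ and, if $v\in\{v_1,\dots,v_n\}$, $f(g(v_1),\dots,g(v_n))=g(v)$; $f$ is undefined elsewhere. $f$ is a partial polymorphism of $R$ if for all $t^{(1)},\dots,t^{(n)}\in R$ whose columns all lie in the domain of $f$, the tuple of values of $f$ on the columns lies in $R$. The $k$-cube pattern $U_k$ has arity $2^k-1$, variables $\{x,y\}$, and consists of $P_i=(X_i,y)$ for $i\in[k]$, where position $j$ of $X_i$ is $x$ if the $i$-th bit of the binary expansion of $j$ is $1$ and $y$ otherwise. For a pattern with pairs $P_1=(X_1,y_1),\dots,P_m=(X_m,y_m)$, the power $P^c$ consists, for each $S=\{i_1<\dots<i_c\}\subseteq[m]$, of the pair $(X_S,y_S)$ with $X_S[p]=(X_{i_1}[p],\dots,X_{i_c}[p])$ and $y_S=(y_{i_1},\dots,y_{i_c})$ (tuples of variables treated as variables). -}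

module Defs where

open import Data.Nat using (ℕ; zero; suc; _∸_; _^_; _%_; _/_; _≡ᵇ_; _<_)
open import Data.Fin using (Fin; toℕ) renaming (_<_ to _<ᶠ_)
open import Data.Vec using (Vec; map; lookup; tabulate)
open import Data.Vec.Relation.Unary.All using (All)
open import Data.Bool using (Bool; true; false)
open import Data.Maybe using (Maybe; just)
open import Data.Product using (Σ; ∃; _×_; _,_; proj₁; proj₂)
open import Relation.Binary.PropositionalEquality using (_≡_)

PFun : Set → ℕ → Set
PFun D n = Vec D n → Maybe D

record Pattern (n : ℕ) (V : Set) : Set₁ where
  field
    Idx : Set
    pat : Idx → Vec V n × V
open Pattern public

Defined : {D : Set} {n : ℕ} → PFun D n → Vec D n → Set
Defined {D} f t = Σ D λ a → f t ≡ just a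

_occursIn_ : {V : Set} {n : ℕ} → V → Vec V n → Set
_occursIn_ {n = n} v X = Σ (Fin n) λ j → lookup X j ≡ v

InI : (D : Set) {n : ℕ} {V : Set} → Pattern n V → PFun D n → Set
InI D {n} {V} P f =
  (∀ (t : Vec D n) →
     (Defined f t → Σ (Idx P) λ i → Σ (V → D) λ g → t ≡ map g (proj₁ (pat P i)))
   × ((Σ (Idx P) λ i → Σ (V → D) λ g → t ≡ map g (proj₁ (pat P i))) → Defined f t))
  × (∀ (i : Idx P) (g : V → D) → proj₂ (pat P i) occursIn proj₁ (pat P i) →
       f (map g (proj₁ (pat P i))) ≡ just (g (proj₂ (pat P i))))

IsPartialPolymorphism : {D : Set} {r n : ℕ} → (Vec D r → Bool) → PFun D n → Set
IsPartialPolymorphism {D} {r} {n} R f =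
  ∀ (ts : Vec (Vec D r) n) → All (λ t → R t ≡ true) ts →
  ∀ (u : Vec D r) →
  (∀ (j : Fin r) → f (map (λ t → lookup t j) ts) ≡ just (lookup u j)) →
  R u ≡ true

-- i-th bit (0-based, least significant first) of the binary expansion of n
testBit : ℕ → ℕ → Bool
testBit n zero    = n % 2 ≡ᵇ 1
testBit n (suc i) = testBit (n / 2) i

-- The k-cube pattern U_k: arity 2^k − 1, variables {x,y} as Bool with
-- x = true, y = false. Position p : Fin (2^k ∸ 1) stands for j = p + 1 ∈ [2^k − 1],
-- pair i : Fin k stands for P_{i+1} (bit i+1 counted from 1 = least significant).
Cube : (k : ℕ) → Pattern (2 ^ k ∸ 1) Bool
Cube k = record
  { Idx = Fin k
  ; pat = λ i → tabulate (λ p → testBit (suc (toℕ p)) (toℕ i)) , false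
  }

-- Strictly increasing enumeration i_1 < … < i_c of a c-subset S of the index set.
StrictlyIncreasing : {c m : ℕ} → Vec (Fin m) c → Set
StrictlyIncreasing {c} s = ∀ (a b : Fin c) → a <ᶠ b → lookup s a <ᶠ lookup s b

Power : {n m : ℕ} {V : Set} → (Fin m → Vec V n × V) → (c : ℕ) → Pattern n (Vec V c)
Power {n} {m} {V} P c = record
  { Idx = Σ (Vec (Fin m) c) StrictlyIncreasing
  ; pat = λ S → tabulate (λ p → map (λ i → lookup (proj₁ (P i)) p) (proj₁ S))
              , map (λ i → proj₂ (P i)) (proj₁ S)
  }

CubePower : (k c : ℕ) → Pattern (2 ^ k ∸ 1) (Vec Bool c)
CubePower k c = Power (pat (Cube k)) c

-- Let f ∈ I(U_p^q) send the columns of t¹,…,tⁿ ∈ R to u. Column j is an instance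
-- g_j(X_{S_j}) of the pair of U_p^q indexed by a q-subset S_j of [p], and u_j = g_j(y).
-- Call e ∈ [p] selected by α ∈ {0,1}^r if e lies in no S_k, or in exactly one S_k and
-- α_k = 1. On S_j the selected set is α_j ∧ (a pattern not depending on α), so taking, for
-- each nonzero α, the row of U_p^q whose bit set is the set selected by α turns column j
-- into an instance of the j-th pair of U_r with y-value u_j. That set is nonempty because
-- the q(r − 1) elements of the other S_k cannot exhaust [p]. Since r ≥ 2 the y-value of an
-- instance of U_r is determined by the tuple, so the member of I(U_r) mapping each instance
-- to its y-value exists, and the hypothesis applied to it and the selected rows gives u ∈ R.
module Submission where

open import Defs
open import Data.Bool using (Bool; true; false; _∧_; _∨_; not; if_then_else_)
open import Data.Bool.Properties using (∧-identityʳ; ∧-zeroʳ; ∨-zeroʳ)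
open import Data.Empty using (⊥-elim)
open import Data.Fin using (Fin; zero; suc; toℕ; fromℕ<; _≟_; punchIn; punchOut; combine; remQuot)
open import Data.Fin.Properties
  using ( any?; all?; ¬∀⟶∃¬; <⇒notInjective; toℕ<n; toℕ-fromℕ<; remQuot-combine
        ; punchIn-punchOut; punchInᵢ≢i )
open import Data.List using (List; []; _∷_; filter; allFin)
open import Data.List.Membership.Propositional using () renaming (_∈_ to _∈ₗ_)
open import Data.List.Membership.Propositional.Properties using (∈-filter⁺; ∈-filter⁻; ∈-allFin)
open import Data.List.Relation.Unary.All using (_∷_)
open import Data.List.Relation.Unary.AllPairs using (_∷_)
open import Data.List.Relation.Unary.Any using (here; there)
open import Data.List.Relation.Unary.Unique.Propositional using (Unique)
open import Data.List.Relation.Unary.Unique.Propositional.Properties using (filter⁺; allFin⁺)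
open import Data.Maybe using (just; nothing)
open import Data.Maybe.Properties using (just-injective)
open import Data.Nat using (ℕ; zero; suc; _+_; _*_; _∸_; _^_; _%_; _/_; _≡ᵇ_; _≤_; _<_; z≤n; s≤s)
open import Data.Nat.DivMod using (m≡m%n+[m/n]*n; m%n<n; [m+kn]%n≡m%n; m*n%n≡0; m*n/n≡m; +-distrib-/)
open import Data.Nat.Properties
  using ( ≤-refl; <⇒≢; n≢0⇒n>0; *-comm; +-monoˡ-<; *-monoʳ-≤; *-cancelʳ-<; ∸-monoˡ-≤
        ; m≤pred[n]⇒suc[m]≤n; m^n≢0; m≤n*m; ≤-<-trans; module ≤-Reasoning )
open import Data.Product using (∃-syntax; _×_; _,_; proj₁; proj₂)
open import Data.Vec using (Vec; []; _∷_; map; lookup; tabulate)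
open import Data.Vec.Membership.Propositional using () renaming (_∈_ to _∈ᵥ_; _∉_ to _∉ᵥ_)
open import Data.Vec.Properties using (lookup-map; lookup∘tabulate; map-cong; tabulate-∘; tabulate-cong; ≡-dec)
open import Data.Vec.Relation.Unary.All.Properties using (lookup⁺; tabulate⁺)
import Data.Vec.Relation.Unary.Any as Anyᵥ
open import Data.Vec.Relation.Unary.Any.Properties using (lookup-index)
open import Function using (_∘_)
open import Function.Definitions using (Injective)
open import Relation.Binary.PropositionalEquality
open import Relation.Nullary using (Dec; yes; no; ¬?; contradiction; does)
open import Relation.Nullary.Decidable using (dec-true; dec-false; decidable-stable)

-- Binary expansions

bitValue : Bool → ℕ
bitValue false = 0
bitValue true  = 1

bit : ∀ {n} → Fin (2 ^ n ∸ 1) → Fin n → Bool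
bit a i = testBit (suc (toℕ a)) (toℕ i)

testBit[0]≡false : ∀ i → testBit 0 i ≡ false
testBit[0]≡false zero    = refl
testBit[0]≡false (suc i) = testBit[0]≡false i

testBit-head : ∀ b m → testBit (bitValue b + m * 2) 0 ≡ b
testBit-head false m = cong (_≡ᵇ 1) (m*n%n≡0 m 2)
testBit-head true  m = cong (_≡ᵇ 1) ([m+kn]%n≡m%n 1 m 2)

[bitValue+m*2]/2≡m : ∀ b m → (bitValue b + m * 2) / 2 ≡ m
[bitValue+m*2]/2≡m false m = m*n/n≡m m 2
[bitValue+m*2]/2≡m true  m = trans (+-distrib-/ 1 (m * 2) 1+m*2%2<2) (m*n/n≡m m 2)
  where
  1+m*2%2<2 : 1 + m * 2 % 2 < 2
  1+m*2%2<2 = subst (λ x → 1 + x < 2) (sym (m*n%n≡0 m 2)) ≤-refl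

testBit-tail : ∀ b m i → testBit (bitValue b + m * 2) (suc i) ≡ testBit m i
testBit-tail b m i = cong (λ n → testBit n i) ([bitValue+m*2]/2≡m b m)

parity : ∀ m → m ≡ bitValue (testBit m 0) + m / 2 * 2
parity m = trans (m≡m%n+[m/n]*n m 2) (cong (_+ m / 2 * 2) (bitValue[≡ᵇ1] (m % 2) (m%n<n m 2)))
  where
  bitValue[≡ᵇ1] : ∀ r → r < 2 → r ≡ bitValue (r ≡ᵇ 1)
  bitValue[≡ᵇ1] 0 _ = refl
  bitValue[≡ᵇ1] 1 _ = refl
  bitValue[≡ᵇ1] (suc (suc _)) (s≤s (s≤s ()))

fromBits : ∀ {n} → (Fin n → Bool) → ℕ
fromBits {zero}  B = 0
fromBits {suc n} B = bitValue (B zero) + fromBits (B ∘ suc) * 2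

testBit-fromBits : ∀ {n} (B : Fin n → Bool) i → testBit (fromBits B) (toℕ i) ≡ B i
testBit-fromBits B zero    = testBit-head (B zero) (fromBits (B ∘ suc))
testBit-fromBits B (suc i) =
  trans (testBit-tail (B zero) (fromBits (B ∘ suc)) (toℕ i)) (testBit-fromBits (B ∘ suc) i)

fromBits<2^n : ∀ {n} (B : Fin n → Bool) → fromBits B < 2 ^ n
fromBits<2^n {zero}  B = s≤s z≤n
fromBits<2^n {suc n} B = begin-strict
  bitValue (B zero) + m * 2  <⟨ +-monoˡ-< (m * 2) (bitValue<2 (B zero)) ⟩
  suc m * 2                  ≡⟨ *-comm (suc m) 2 ⟩
  2 * suc m                  ≤⟨ *-monoʳ-≤ 2 (fromBits<2^n (B ∘ suc)) ⟩
  2 * 2 ^ n                  ∎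
  where
  open ≤-Reasoning
  m : ℕ
  m = fromBits (B ∘ suc)
  bitValue<2 : ∀ b → bitValue b < 2
  bitValue<2 false = s≤s z≤n
  bitValue<2 true  = s≤s (s≤s z≤n)

positionWithBits : ∀ {n} (B : Fin n → Bool) → ∃[ i ] B i ≡ true → ∃[ a ] (∀ i → bit a i ≡ B i)
positionWithBits {n} B (i , Bi≡true) with fromBits B | testBit-fromBits B | fromBits<2^n B
... | zero  | bits | _     =
  contradiction (trans (sym (testBit[0]≡false (toℕ i))) (trans (bits i) Bi≡true)) λ ()
... | suc m | bits | m<2^n =
  fromℕ< m<2^n∸1 , λ j → trans (cong (λ k → testBit (suc k) (toℕ j)) (toℕ-fromℕ< m<2^n∸1)) (bits j)
  where
  m<2^n∸1 : m < 2 ^ n ∸ 1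
  m<2^n∸1 = ∸-monoˡ-≤ 1 m<2^n

someBitSet : ∀ n m → 0 < m → m < 2 ^ n → ∃[ i ] testBit m (toℕ {n} i) ≡ true
someBitSet zero    (suc m) _ (s≤s ())
someBitSet (suc n) m 0<m m<2^[1+n] with testBit m 0 in m₀
... | true  = zero , m₀
... | false = let i , bit-i = someBitSet n (m / 2) 0<m/2 m/2<2^n in suc i , bit-i
  where
  m≡m/2*2 : m ≡ m / 2 * 2
  m≡m/2*2 = trans (parity m) (cong (λ b → bitValue b + m / 2 * 2) m₀)
  0<m/2 : 0 < m / 2
  0<m/2 = n≢0⇒n>0 λ m/2≡0 → <⇒≢ 0<m (sym (trans m≡m/2*2 (cong (_* 2) m/2≡0)))
  m/2<2^n : m / 2 < 2 ^ n
  m/2<2^n = *-cancelʳ-< 2 (m / 2) (2 ^ n) (subst₂ _<_ m≡m/2*2 (*-comm 2 (2 ^ n)) m<2^[1+n])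

bit-nonzero : ∀ {n} (a : Fin (2 ^ n ∸ 1)) → ∃[ i ] bit a i ≡ true
bit-nonzero {n} a = someBitSet n (suc (toℕ a)) (s≤s z≤n) (m≤pred[n]⇒suc[m]≤n {{m^n≢0 2 n}} (toℕ<n a))

-- Counting

outsideImage : ∀ {m n} → m < n → (φ : Fin m → Fin n) → ∃[ e ] (∀ i → φ i ≢ e)
outsideImage {m} m<n φ with any? (λ e → all? (λ i → ¬? (φ i ≟ e)))
... | yes outside = outside
... | no  none    = ⊥-elim (<⇒notInjective m<n preimage-injective)
  where
  preimage : ∀ e → ∃[ i ] φ i ≡ e
  preimage e with i , ¬φi≢e ← ¬∀⟶∃¬ m _ (λ i → ¬? (φ i ≟ e)) (λ outside → none (e , outside))
    = i , decidable-stable (φ i ≟ e) ¬φi≢e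
  preimage-injective : Injective _≡_ _≡_ (proj₁ ∘ preimage)
  preimage-injective {e} {e′} eq = trans (sym (proj₂ (preimage e))) (trans (cong φ eq) (proj₂ (preimage e′)))

_∈ᵥ?_ : ∀ {p n} (e : Fin p) (xs : Vec (Fin p) n) → Dec (e ∈ᵥ xs)
e ∈ᵥ? xs = Anyᵥ.any? (e ≟_) xs

∃∉ : ∀ {p q} → q < p → (xs : Vec (Fin p) q) → ∃[ e ] e ∉ᵥ xs
∃∉ q<p xs with e , outside ← outsideImage q<p (lookup xs)
  = e , λ e∈xs → outside (Anyᵥ.index e∈xs) (sym (lookup-index e∈xs))

map-cong-∈ : ∀ {A B : Set} {n} {f g : A → B} (xs : Vec A n) →
             (∀ {x} → x ∈ᵥ xs → f x ≡ g x) → map f xs ≡ map g xs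
map-cong-∈ []       f≡g = refl
map-cong-∈ (x ∷ xs) f≡g = cong₂ _∷_ (f≡g (Anyᵥ.here refl)) (map-cong-∈ xs (f≡g ∘ Anyᵥ.there))

-- Selected elements

selectedBy : ∀ {r} → (Fin r → Bool) → List (Fin r) → Bool
selectedBy α []          = true
selectedBy α (k ∷ [])    = α k
selectedBy α (_ ∷ _ ∷ _) = false

selectedBy-∈ : ∀ {r} (α : Fin r → Bool) {k ks} → k ∈ₗ ks →
               selectedBy α ks ≡ α k ∧ selectedBy (λ _ → true) ks
selectedBy-∈ α {ks = _ ∷ []}    (here refl) = sym (∧-identityʳ (α _))
selectedBy-∈ α {ks = _ ∷ _ ∷ _} _           = sym (∧-zeroʳ (α _))

selectedBy-⊆[_] : ∀ {r} (k : Fin r) {α : Fin r → Bool} {ks} → Unique ks → α k ≡ true →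
                  (∀ {k′} → k′ ∈ₗ ks → k′ ≡ k) → selectedBy α ks ≡ true
selectedBy-⊆[ k ] {ks = []}         _                 _  _  = refl
selectedBy-⊆[ k ] {α} {ks = _ ∷ []} _                 αk ⊆k = trans (cong α (⊆k (here refl))) αk
selectedBy-⊆[ k ] {ks = _ ∷ _ ∷ _}  ((k₁≢k₂ ∷ _) ∷ _) _  ⊆k =
  contradiction (trans (⊆k (here refl)) (sym (⊆k (there (here refl))))) k₁≢k₂

module Covering {r p q : ℕ} (S : Fin r → Vec (Fin p) q) where

  owners : Fin p → List (Fin r)
  owners e = filter (λ k → e ∈ᵥ? S k) (allFin r)

  ∈-owners : ∀ {e k} → e ∈ᵥ S k → k ∈ₗ owners e
  ∈-owners {e} {k} = ∈-filter⁺ (λ k → e ∈ᵥ? S k) (∈-allFin k)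

  owners-∈ : ∀ {e k} → k ∈ₗ owners e → e ∈ᵥ S k
  owners-∈ {e} = proj₂ ∘ ∈-filter⁻ (λ k → e ∈ᵥ? S k) {xs = allFin r}

  owners-unique : ∀ e → Unique (owners e)
  owners-unique e = filter⁺ (λ k → e ∈ᵥ? S k) (allFin⁺ r)

  selected : (Fin r → Bool) → Fin p → Bool
  selected α e = selectedBy α (owners e)

  selected-∈ : ∀ (α : Fin r → Bool) {e j} → e ∈ᵥ S j →
               selected α e ≡ α j ∧ selected (λ _ → true) e
  selected-∈ α e∈Sj = selectedBy-∈ α (∈-owners e∈Sj)

module _ {r p q : ℕ} (S : Fin (suc r) → Vec (Fin p) q) where
  open Covering S

  outsideOthers : r * q < p → (k : Fin (suc r)) → ∃[ e ] (∀ {k′} → k′ ≢ k → e ∉ᵥ S k′)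
  outsideOthers r*q<p k =
    let e , outside = outsideImage r*q<p (entry ∘ remQuot q)
    in  e , λ k′≢k e∈Sk′ →
              outside (combine (punchOut (≢-sym k′≢k)) (Anyᵥ.index e∈Sk′)) (hit k′≢k e∈Sk′)
    where
    -- entry ∘ remQuot q enumerates the r * q entries of the S k′ with k′ ≢ k.
    entry : Fin r × Fin q → Fin p
    entry (k′ , l) = lookup (S (punchIn k k′)) l
    hit : ∀ {e k′} (k′≢k : k′ ≢ k) (e∈Sk′ : e ∈ᵥ S k′) →
          entry (remQuot q (combine (punchOut (≢-sym k′≢k)) (Anyᵥ.index e∈Sk′))) ≡ e
    hit {e} {k′} k′≢k e∈Sk′ = begin
      entry (remQuot q (combine (punchOut k≢k′) l))  ≡⟨ cong entry (remQuot-combine (punchOut k≢k′) l) ⟩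
      lookup (S (punchIn k (punchOut k≢k′))) l      ≡⟨ cong (λ k″ → lookup (S k″) l) (punchIn-punchOut k≢k′) ⟩
      lookup (S k′) l                               ≡⟨ lookup-index e∈Sk′ ⟨
      e                                             ∎
      where
      open ≡-Reasoning
      k≢k′ : k ≢ k′
      k≢k′ = ≢-sym k′≢k
      l : Fin q
      l = Anyᵥ.index e∈Sk′

  selected-nonzero : r * q < p → (α : Fin (suc r) → Bool) →
                     ∃[ k ] α k ≡ true → ∃[ e ] selected α e ≡ true
  selected-nonzero r*q<p α (k , αk≡true) with e , e∉others ← outsideOthers r*q<p k
    = e , selectedBy-⊆[ k ] (owners-unique e) αk≡true
            λ {k′} k′∈owners → decidable-stable (k′ ≟ k) λ k′≢k → e∉others k′≢k (owners-∈ k′∈owners)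

-- The cube patterns

cubeRow : ∀ k → Fin k → Vec Bool (2 ^ k ∸ 1)
cubeRow k i = proj₁ (pat (Cube k) i)

lookup-cubeRow : ∀ {k} (i : Fin k) a → lookup (cubeRow k i) a ≡ bit a i
lookup-cubeRow i = lookup∘tabulate (λ a → bit a i)

only : ∀ {n} → Fin n → Fin n → Bool
only i j = does (j ≟ i)

only-self : ∀ {n} (i : Fin n) → only i i ≡ true
only-self i = dec-true (i ≟ i) refl

only-other : ∀ {n} {i j : Fin n} → j ≢ i → only i j ≡ false
only-other {i = i} {j} j≢i = dec-false (j ≟ i) j≢i

cubeRows-agree : ∀ {k} {A : Set} {g g′ : Bool → A} (i i′ : Fin k) →
  map g (cubeRow k i) ≡ map g′ (cubeRow k i′) →
  (B : Fin k → Bool) → ∃[ j ] B j ≡ true → ∀ {b b′} → B i ≡ b → B i′ ≡ b′ → g b ≡ g′ b′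
cubeRows-agree {k} {g = g} {g′} i i′ rows≡ B nonzero {b} {b′} Bi≡b Bi′≡b′
  with a , bits ← positionWithBits B nonzero = begin
  g b                              ≡⟨ cong g (trans (sym Bi≡b) (sym (bits i))) ⟩
  g (bit a i)                      ≡⟨ cong g (lookup-cubeRow i a) ⟨
  g (lookup (cubeRow k i) a)       ≡⟨ lookup-map a g (cubeRow k i) ⟨
  lookup (map g (cubeRow k i)) a   ≡⟨ cong (λ t → lookup t a) rows≡ ⟩
  lookup (map g′ (cubeRow k i′)) a ≡⟨ lookup-map a g′ (cubeRow k i′) ⟩
  g′ (lookup (cubeRow k i′) a)     ≡⟨ cong g′ (trans (lookup-cubeRow i′ a) (trans (bits i′) Bi′≡b′)) ⟩
  g′ b′                            ∎
  where open ≡-Reasoning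

cubeRow-yOccurs : ∀ {k} (i : Fin (suc (suc k))) → false occursIn cubeRow _ i
cubeRow-yOccurs i =
  let a , bits = positionWithBits (only o) (o , only-self o)
  in  a , trans (lookup-cubeRow i a) (trans (bits i) (only-other (≢-sym (punchInᵢ≢i i zero))))
  where
  o : Fin _
  o = punchIn i zero

cubeInstance-yValue : ∀ {k} {A : Set} {g g′ : Bool → A} (i i′ : Fin (suc (suc k))) →
  map g (cubeRow _ i) ≡ map g′ (cubeRow _ i′) → g false ≡ g′ false
cubeInstance-yValue i i′ rows≡ with i ≟ i′
... | yes refl = cubeRows-agree i i rows≡ (only o) (o , only-self o) only-o-i only-o-i
  where
  o : Fin _
  o = punchIn i zero
  only-o-i : only o i ≡ false
  only-o-i = only-other (≢-sym (punchInᵢ≢i i zero))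
cubeInstance-yValue {g = g} {g′} i i′ rows≡ | no i≢i′ = begin
  g false   ≡⟨ cubeRows-agree i i′ rows≡ (only i′) (i′ , only-self i′) (only-other i≢i′) (only-self i′) ⟩
  g′ true   ≡⟨ cubeRows-agree i i′ rows≡ both (i , both-i) both-i both-i′ ⟨
  g true    ≡⟨ cubeRows-agree i i′ rows≡ (only i) (i , only-self i) (only-self i) (only-other (≢-sym i≢i′)) ⟩
  g′ false  ∎
  where
  open ≡-Reasoning
  both : Fin _ → Bool
  both j = only i j ∨ only i′ j
  both-i : both i ≡ true
  both-i = cong (_∨ only i′ i) (only-self i)
  both-i′ : both i′ ≡ true
  both-i′ = trans (cong (only i i′ ∨_) (only-self i′)) (∨-zeroʳ (only i i′))

module CubeSelector {d k : ℕ} where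

  private
    K : ℕ
    K = suc (suc k)

  choose : Fin d → Fin d → Bool → Fin d
  choose b c x = if x then b else c

  map-choose : ∀ (g : Bool → Fin d) {n} (xs : Vec Bool n) → map g xs ≡ map (choose (g true) (g false)) xs
  map-choose g = map-cong λ { true → refl ; false → refl }

  IsCubeInstance : Vec (Fin d) (2 ^ K ∸ 1) → Set
  IsCubeInstance t = ∃[ i ] ∃[ b ] ∃[ c ] t ≡ map (choose b c) (cubeRow K i)

  isCubeInstance? : ∀ t → Dec (IsCubeInstance t)
  isCubeInstance? t = any? λ i → any? λ b → any? λ c → ≡-dec _≟_ t (map (choose b c) (cubeRow K i))

  cubeSelector : PFun (Fin d) (2 ^ K ∸ 1)
  cubeSelector t with isCubeInstance? t
  ... | yes (_ , _ , c , _) = just c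
  ... | no _                = nothing

  cubeSelector∈I : InI (Fin d) (Cube K) cubeSelector
  cubeSelector∈I = (λ t → defined⇒instance t , instance⇒defined t) , value
    where
    defined⇒instance : ∀ t → Defined cubeSelector t → ∃[ i ] ∃[ g ] t ≡ map g (cubeRow K i)
    defined⇒instance t with isCubeInstance? t
    ... | yes (i , b , c , t≡) = λ _ → i , choose b c , t≡
    ... | no _                 = λ ()

    instance⇒defined : ∀ t → (∃[ i ] ∃[ g ] t ≡ map g (cubeRow K i)) → Defined cubeSelector t
    instance⇒defined t (i , g , t≡) with isCubeInstance? t
    ... | yes (_ , _ , c , _) = c , refl
    ... | no ¬instance        = contradiction (i , g true , g false , trans t≡ (map-choose g _)) ¬instance

    value : ∀ i (g : Bool → Fin d) → false occursIn cubeRow K i →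
            cubeSelector (map g (cubeRow K i)) ≡ just (g false)
    value i g _ with isCubeInstance? (map g (cubeRow K i))
    ... | yes (i′ , b , c , rows≡) = cong just (sym (cubeInstance-yValue i i′ rows≡))
    ... | no ¬instance             = contradiction (i , g true , g false , map-choose g _) ¬instance

open CubeSelector using (cubeSelector; cubeSelector∈I)

-- proj₁ (pat (CubePower p q) (S , _)) reduces to powerRow S.
powerRow : ∀ {p q} → Vec (Fin p) q → Vec (Vec Bool q) (2 ^ p ∸ 1)
powerRow {p} S = tabulate λ a → map (λ i → lookup (cubeRow p i) a) S

lookup-powerRow : ∀ {p q} (S : Vec (Fin p) q) a → lookup (powerRow S) a ≡ map (bit a) S
lookup-powerRow S a = trans (lookup∘tabulate _ a) (map-cong (λ i → lookup-cubeRow i a) S)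

powerRow-yOccurs : ∀ {p q} → q < p → (S : Vec (Fin p) q) → map (λ _ → false) S occursIn powerRow S
powerRow-yOccurs {p} q<p S =
  let a , bits = positionWithBits outside outside-nonzero
  in  a , (begin
    lookup (powerRow S) a  ≡⟨ lookup-powerRow S a ⟩
    map (bit a) S          ≡⟨ map-cong-∈ S (λ e∈S → trans (bits _) (cong not (dec-true (_ ∈ᵥ? S) e∈S))) ⟩
    map (λ _ → false) S    ∎)
  where
  open ≡-Reasoning
  outside : Fin p → Bool
  outside e = not (does (e ∈ᵥ? S))
  outside-nonzero : ∃[ e ] outside e ≡ true
  outside-nonzero = let e , e∉S = ∃∉ q<p S in e , cong not (dec-false (e ∈ᵥ? S) e∉S)

instanceOfDefined : ∀ {D : Set} {n} {V : Set} {P : Pattern n V} {f : PFun D n} → InI D P f →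
  ∀ {t v} → f t ≡ just v → ∃[ i ] ∃[ g ] t ≡ map g (proj₁ (pat P i)) ×
    (proj₂ (pat P i) occursIn proj₁ (pat P i) → v ≡ g (proj₂ (pat P i)))
instanceOfDefined {f = f} f∈I {t} {v} ft≡v =
  let i , g , t≡ = proj₁ (proj₁ f∈I t) (v , ft≡v)
  in  i , g , t≡ , λ occurs → just-injective (trans (sym ft≡v) (trans (cong f t≡) (proj₂ f∈I i g occurs)))

cubePowerInstance : ∀ {D : Set} {p q} {f : PFun D (2 ^ p ∸ 1)} → q < p → InI D (CubePower p q) f →
  ∀ {t v} → f t ≡ just v → ∃[ S ] ∃[ g ] t ≡ map g (powerRow S) × v ≡ g (map (λ _ → false) S)
cubePowerInstance q<p f∈I ft≡v =
  let (S , _) , g , t≡ , v≡ = instanceOfDefined f∈I ft≡v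
  in  S , g , t≡ , v≡ (powerRow-yOccurs q<p S)

-- Selecting rows

column : ∀ {A : Set} {m n} → Fin m → Vec (Vec A m) n → Vec A n
column j = map (λ t → lookup t j)

module RowSelection {r p q : ℕ} (S : Fin (suc r) → Vec (Fin p) q) (r*q<p : r * q < p) where
  open Covering S

  rowWithBits : ∀ a → ∃[ s ] (∀ e → bit s e ≡ selected (bit a) e)
  rowWithBits a = positionWithBits (selected (bit a)) (selected-nonzero S r*q<p (bit a) (bit-nonzero a))

  row : Fin (2 ^ suc r ∸ 1) → Fin (2 ^ p ∸ 1)
  row a = proj₁ (rowWithBits a)

  selectRows : ∀ {A : Set} → Vec A (2 ^ p ∸ 1) → Vec A (2 ^ suc r ∸ 1)
  selectRows ts = tabulate (lookup ts ∘ row)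

  restriction : Fin (suc r) → Bool → Vec Bool q
  restriction j b = map (λ e → b ∧ selected (λ _ → true) e) (S j)

  lookup-powerRow-row : ∀ j a → lookup (powerRow (S j)) (row a) ≡ restriction j (bit a j)
  lookup-powerRow-row j a = begin
    lookup (powerRow (S j)) (row a)  ≡⟨ lookup-powerRow (S j) (row a) ⟩
    map (bit (row a)) (S j)          ≡⟨ map-cong (proj₂ (rowWithBits a)) (S j) ⟩
    map (selected (bit a)) (S j)     ≡⟨ map-cong-∈ (S j) (selected-∈ (bit a)) ⟩
    restriction j (bit a j)          ∎
    where open ≡-Reasoning

  column-selectRows : ∀ {A : Set} (ts : Vec (Vec A (suc r)) (2 ^ p ∸ 1)) j (g : Vec Bool q → A) →
    column j ts ≡ map g (powerRow (S j)) → column j (selectRows ts) ≡ map (g ∘ restriction j) (cubeRow _ j)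
  column-selectRows ts j g column≡ = begin
    column j (selectRows ts)                       ≡⟨ tabulate-∘ (λ t → lookup t j) (lookup ts ∘ row) ⟨
    tabulate (λ a → lookup (lookup ts (row a)) j)  ≡⟨ tabulate-cong (λ a → lookup-map (row a) (λ t → lookup t j) ts) ⟨
    tabulate (λ a → lookup (column j ts) (row a))  ≡⟨ tabulate-cong (λ a → cong (λ c → lookup c (row a)) column≡) ⟩
    tabulate (λ a → lookup (map g rows) (row a))   ≡⟨ tabulate-cong (λ a → lookup-map (row a) g rows) ⟩
    tabulate (λ a → g (lookup rows (row a)))       ≡⟨ tabulate-cong (λ a → cong g (lookup-powerRow-row j a)) ⟩
    tabulate (λ a → g (restriction j (bit a j)))   ≡⟨ tabulate-∘ (g ∘ restriction j) (λ a → bit a j) ⟩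
    map (g ∘ restriction j) (cubeRow _ j)          ∎
    where
    open ≡-Reasoning
    rows : Vec (Vec Bool q) (2 ^ p ∸ 1)
    rows = powerRow (S j)

lemma5p51 : (d r : ℕ) → 2 ≤ r → (R : Vec (Fin d) r → Bool) →
    (∀ f → InI (Fin d) (Cube r) f → IsPartialPolymorphism R f) →
    (p q : ℕ) → 1 ≤ p → 1 ≤ q → q * (r ∸ 1) < p →
    ∀ f → InI (Fin d) (CubePower p q) f → IsPartialPolymorphism R f
lemma5p51 d (suc zero) (s≤s ())
lemma5p51 d (suc (suc r)) _ R cube-closed p q _ _ q*[1+r]<p f f∈I ts ts∈R u f[ts]≡u =
  cube-closed (cubeSelector {k = r}) cubeSelector∈I (selectRows ts) (tabulate⁺ (lookup⁺ ts∈R ∘ row)) u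
    cubeSelector[ts′]≡u
  where
  [1+r]*q<p : suc r * q < p
  [1+r]*q<p = subst (_< p) (*-comm q (suc r)) q*[1+r]<p
  q<p : q < p
  q<p = ≤-<-trans (m≤n*m q (suc r)) [1+r]*q<p
  instanceOf : ∀ j → ∃[ S ] ∃[ g ]
    column j ts ≡ map g (powerRow S) × lookup u j ≡ g (map (λ _ → false) S)
  instanceOf j = cubePowerInstance q<p f∈I (f[ts]≡u j)
  open RowSelection (proj₁ ∘ instanceOf) [1+r]*q<p
  cubeSelector[ts′]≡u : ∀ j → cubeSelector (column j (selectRows ts)) ≡ just (lookup u j)
  cubeSelector[ts′]≡u j = let _ , g , column≡ , u≡ = instanceOf j in begin
    cubeSelector (column j (selectRows ts))               ≡⟨ cong cubeSelector (column-selectRows ts j g column≡) ⟩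
    cubeSelector (map (g ∘ restriction j) (cubeRow _ j))  ≡⟨ proj₂ cubeSelector∈I j _ (cubeRow-yOccurs j) ⟩
    just (g (map (λ _ → false) _))                        ≡⟨ cong just u≡ ⟨
    just (lookup u j)                                     ∎
    where open ≡-Reasoning
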